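{- For integers $m\ge 1$ and arbitrary integers $a,b$, let $G_m(a,b)$ denote the number of bitstrings of length $m$ that are pinned and solus and that contain exactly $a$ zeros and have a longest run of zeros of length exactly $b$ (so $G_m(a,b)=0$ whenever no such string exists). Let $n\ge 1$ and let $x,y$ be integers with $0\le y\le x\le n$. Then $G_n(n,n)=1$, and if $(x,y)\neq(n,n)$ then \[ G_n(x,y)=\begin{cases} \displaystyle\sum_{i=1}^{y-1}G_{n-i-1}(x-i,y)+\sum_{j=0}^{y}G_{n-y-1}(x-y,j) & \text{if } 1\le x\le n-2 \text{ and } \varepsilon_n(x,y)=1,\\[2mm] \lambda_n(y) & \text{if } x=n-1 \text{ and } \varepsilon_n(x,y)=1,\\[1mm] 0 & \text{otherwise}, \end{cases} \] where \[ \varepsilon_n(x,y)=\begin{cases}1 & \text{if } n\ge x \text{ and } \left(\left\lfloor \frac{n}{n-x+1}\right\rfloor\le y<x \text{ or } x=y=n\right),\\ 0&\text{otherwise,}\end{cases} \qquad \lambda_n(y)=\begin{cases}1 & \text{if } n \text{ is odd and } y=\frac{n-1}{2},\\ 2 & \text{if } \left\lfloor\frac{n-1}{2}\right\rfloor<y<n-1,\\ 0&\text{otherwise.}\end{cases} \] In particular $G_n(0,0)=0$ for all $n\ge1$.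
   Context: A bitstring is a finite sequence of symbols from $\{0,1\}$. A bitstring is called pinned if its first bit is $0$ and its last bit is $0$. A bitstring is called solus if all of its $1$s are isolated, i.e., no two $1$s are adjacent. A run of zeros is a maximal block of consecutive $0$s; the longest run of zeros of a string is the maximum length of such a block (and $0$ if the string has no zeros). -}

module Defs where

open import Data.Bool using (Bool; true; false; _∧_; if_then_else_; T)
open import Data.Nat using (ℕ; zero; suc; _+_; _*_; _∸_; _⊔_; _≤_; _<_; _≡ᵇ_; _<ᵇ_)
open import Data.Nat.DivMod using (_/_; _%_)
open import Data.List using (List; []; _∷_; length; filter; map; upTo; drop; _++_)
open import Data.Nat.ListAction using (sum)
open import Data.Product using (_×_)
open import Data.Sum using (_⊎_)
open import Relation.Binary.PropositionalEquality using (_≡_)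
open import Relation.Nullary.Decidable using (T?)

-- Bits: false = 0, true = 1.
Bitstring : Set
Bitstring = List Bool

allStrings : ℕ → List Bitstring
allStrings zero = [] ∷ []
allStrings (suc m) = map (false ∷_) (allStrings m) ++ map (true ∷_) (allStrings m)

-- pinned: first bit 0 and last bit 0 (the empty string is not pinned)
lastBit : Bool → List Bool → Bool
lastBit b [] = b
lastBit _ (c ∷ s) = lastBit c s

isPinned : Bitstring → Bool
isPinned [] = false
isPinned (false ∷ s) = if lastBit false s then false else true
isPinned (true ∷ s) = false

isSolus : Bitstring → Bool
isSolus [] = true
isSolus (true ∷ true ∷ s) = false
isSolus (_ ∷ s) = isSolus s

zeros : Bitstring → ℕ
zeros [] = 0
zeros (false ∷ s) = suc (zeros s)
zeros (true ∷ s) = zeros s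

-- longest run of zeros; c = length of the current (unfinished) run of zeros
longestRunFrom : ℕ → Bitstring → ℕ
longestRunFrom c [] = c
longestRunFrom c (false ∷ s) = longestRunFrom (suc c) s
longestRunFrom c (true ∷ s) = c ⊔ longestRunFrom 0 s

longestZeroRun : Bitstring → ℕ
longestZeroRun = longestRunFrom 0

good : ℕ → ℕ → Bitstring → Bool
good a b s = isPinned s ∧ isSolus s ∧ (zeros s ≡ᵇ a) ∧ (longestZeroRun s ≡ᵇ b)

G : ℕ → ℕ → ℕ → ℕ
G m a b = length (filter (λ s → T? (good a b s)) (allStrings m))

EpsOne : ℕ → ℕ → ℕ → Set
EpsOne n x y = x ≤ n × ((n / suc (n ∸ x) ≤ y × y < x) ⊎ (x ≡ n × y ≡ n))

lam : ℕ → ℕ → ℕ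
lam n y =
  if (n % 2 ≡ᵇ 1) ∧ (y ≡ᵇ (n ∸ 1) / 2) then 1
  else if ((n ∸ 1) / 2 <ᵇ y) ∧ (y <ᵇ n ∸ 1) then 2
  else 0

recSum : ℕ → ℕ → ℕ → ℕ
recSum n x y =
  sum (map (λ i → G (n ∸ i ∸ 1) (x ∸ i) y) (drop 1 (upTo y)))
  + sum (map (λ j → G (n ∸ y ∸ 1) (x ∸ y) j) (upTo (suc y)))

-- Cut a string at its first 1: s = 0ʲ 1 t. Then s is pinned and solus with x zeros and longest
-- zero run y exactly when j ≥ 1, t is pinned and solus with x − j zeros, and max(j, L t) = y.
-- Hence j ≤ y: for j < y the tail has longest run y, for j = y any longest run ≤ y, and summing
-- over j gives the recursion. For x = n − 1 there is a single 1, at a position j with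
-- max(j, n − 1 − j) = y, that is j = y or j = n − 1 − y, whence λ. Finally, the o ones of a string
-- cut its zeros into at most o + 1 runs, so the longest run is at least n / (o + 1): this is the
-- condition ε, and no string realises a pair (x, y) violating it.
module Submission where

open import Defs
open import Data.Bool using (Bool; true; false; _∧_; T)
open import Data.Bool.Properties using (∧-assoc; ∧-zeroʳ)
open import Data.Empty using (⊥-elim)
open import Data.List using ([]; _∷_; _++_; length; map; filter; applyUpTo; replicate)
open import Data.List.Properties using (map-++; map-∘; map-applyUpTo; length-++; length-replicate)
open import Data.Nat
open import Data.Nat.DivMod
open import Data.Nat.ListAction using (sum)
open import Data.Nat.ListAction.Properties using (sum-++)
open import Data.Nat.Properties
open import Algebra.Properties.CommutativeSemigroup +-commutativeSemigroup using (interchange)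
open import Data.Product using (_×_; _,_; proj₁; proj₂; ∃; ∃₂)
open import Data.Sum using (_⊎_; inj₁; inj₂; [_,_]′)
open import Function using (_∘_)
open import Relation.Binary.PropositionalEquality
open import Relation.Binary.Definitions using (tri<; tri≈; tri>)
open import Relation.Nullary using (¬_; yes; no; contradiction)
open import Relation.Nullary.Decidable using (T?)

𝟙 : Bool → ℕ
𝟙 true = 1
𝟙 false = 0

𝟙-∧-∧ : ∀ a b c → 𝟙 (a ∧ (b ∧ c)) ≡ 𝟙 (a ∧ b) * 𝟙 c
𝟙-∧-∧ true true c = sym (+-identityʳ (𝟙 c))
𝟙-∧-∧ true false c = refl
𝟙-∧-∧ false b c = refl

T-∧₃ : ∀ {a b c} → T (a ∧ (b ∧ c)) → T a × T b × T c
T-∧₃ {true} {true} t = _ , _ , t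
T-∧₃ {true} {false} ()
T-∧₃ {false} ()

T-injective : ∀ {a b} → (T a → T b) → (T b → T a) → a ≡ b
T-injective {true} {true} _ _ = refl
T-injective {true} {false} a⇒b _ = ⊥-elim (a⇒b _)
T-injective {false} {true} _ b⇒a = ⊥-elim (b⇒a _)
T-injective {false} {false} _ _ = refl

≡ᵇ-cong : ∀ {a b c d} → (a ≡ b → c ≡ d) → (c ≡ d → a ≡ b) → (a ≡ᵇ b) ≡ (c ≡ᵇ d)
≡ᵇ-cong {a} {b} {c} {d} to from =
  T-injective (≡⇒≡ᵇ c d ∘ to ∘ ≡ᵇ⇒≡ a b) (≡⇒≡ᵇ a b ∘ from ∘ ≡ᵇ⇒≡ c d)

<ᵇ-cong : ∀ {a b c d} → (a < b → c < d) → (c < d → a < b) → (a <ᵇ b) ≡ (c <ᵇ d)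
<ᵇ-cong {a} {b} {c} {d} to from = T-injective (<⇒<ᵇ ∘ to ∘ <ᵇ⇒< a b) (<⇒<ᵇ ∘ from ∘ <ᵇ⇒< c d)

≡ᵇ-refl : ∀ n → (n ≡ᵇ n) ≡ true
≡ᵇ-refl zero = refl
≡ᵇ-refl (suc n) = ≡ᵇ-refl n

≡ᵇ-false : ∀ {m n} → m ≢ n → (m ≡ᵇ n) ≡ false
≡ᵇ-false {m} {n} m≢n = T-injective (m≢n ∘ ≡ᵇ⇒≡ m n) λ ()

<ᵇ-true : ∀ {m n} → m < n → (m <ᵇ n) ≡ true
<ᵇ-true m<n = T-injective (λ _ → _) (λ _ → <⇒<ᵇ m<n)

<ᵇ-false : ∀ {m n} → m ≮ n → (m <ᵇ n) ≡ false
<ᵇ-false {m} {n} m≮n = T-injective (m≮n ∘ <ᵇ⇒< m n) λ ()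

∑< : ℕ → (ℕ → ℕ) → ℕ
∑< k f = sum (applyUpTo f k)

syntax ∑< k (λ i → e) = ∑[ i < k ] e

∑-cong : ∀ k {f g : ℕ → ℕ} → (∀ i → i < k → f i ≡ g i) → ∑< k f ≡ ∑< k g
∑-cong zero _ = refl
∑-cong (suc k) f≗g = cong₂ _+_ (f≗g 0 z<s) (∑-cong k λ i i<k → f≗g (suc i) (s<s i<k))

∑-zero : ∀ k {f : ℕ → ℕ} → (∀ i → i < k → f i ≡ 0) → ∑< k f ≡ 0
∑-zero zero _ = refl
∑-zero (suc k) f≗0 = cong₂ _+_ (f≗0 0 z<s) (∑-zero k λ i i<k → f≗0 (suc i) (s<s i<k))

∑-+ : ∀ k (f g : ℕ → ℕ) → ∑[ i < k ] (f i + g i) ≡ ∑< k f + ∑< k g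
∑-+ zero f g = refl
∑-+ (suc k) f g = trans (cong (f 0 + g 0 +_) (∑-+ k (f ∘ suc) (g ∘ suc))) (interchange (f 0) (g 0) _ _)

∑-*ˡ : ∀ k c (f : ℕ → ℕ) → ∑[ i < k ] (c * f i) ≡ c * ∑< k f
∑-*ˡ zero c f = sym (*-zeroʳ c)
∑-*ˡ (suc k) c f = trans (cong (c * f 0 +_) (∑-*ˡ k c (f ∘ suc))) (sym (*-distribˡ-+ c (f 0) _))

∑-split : ∀ a b (f : ℕ → ℕ) → ∑< (a + b) f ≡ ∑< a f + ∑[ i < b ] f (a + i)
∑-split zero b f = refl
∑-split (suc a) b f = trans (cong (f 0 +_) (∑-split a b (f ∘ suc))) (sym (+-assoc (f 0) _ _))

∑-𝟙≡ : ∀ k a → ∑[ j < k ] 𝟙 (a ≡ᵇ j) ≡ 𝟙 (a <ᵇ k)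
∑-𝟙≡ zero a = refl
∑-𝟙≡ (suc k) zero = cong suc (∑-zero k λ _ _ → refl)
∑-𝟙≡ (suc k) (suc a) = ∑-𝟙≡ k a

∑-select : ∀ k c (f : ℕ → ℕ) → c < k → ∑[ i < k ] (𝟙 (c ≡ᵇ i) * f i) ≡ f c
∑-select (suc k) zero f _ =
  trans (cong₂ _+_ (+-identityʳ (f 0)) (∑-zero k λ _ _ → refl)) (+-identityʳ (f 0))
∑-select (suc k) (suc c) f (s<s c<k) = ∑-select k c (f ∘ suc) c<k

∑Strings : ℕ → (Bitstring → ℕ) → ℕ
∑Strings zero f = f []
∑Strings (suc m) f = ∑Strings m (f ∘ (false ∷_)) + ∑Strings m (f ∘ (true ∷_))

sum-map-allStrings : ∀ m (f : Bitstring → ℕ) → sum (map f (allStrings m)) ≡ ∑Strings m f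
sum-map-allStrings zero f = +-identityʳ (f [])
sum-map-allStrings (suc m) f = begin
  sum (map f (map (false ∷_) ss ++ map (true ∷_) ss))
    ≡⟨ cong sum (map-++ f (map (false ∷_) ss) _) ⟩
  sum (map f (map (false ∷_) ss) ++ map f (map (true ∷_) ss))
    ≡⟨ sum-++ (map f (map (false ∷_) ss)) _ ⟩
  sum (map f (map (false ∷_) ss)) + sum (map f (map (true ∷_) ss))
    ≡⟨ cong₂ _+_ (cong sum (sym (map-∘ ss))) (cong sum (sym (map-∘ ss))) ⟩
  sum (map (f ∘ (false ∷_)) ss) + sum (map (f ∘ (true ∷_)) ss)
    ≡⟨ cong₂ _+_ (sum-map-allStrings m _) (sum-map-allStrings m _) ⟩
  ∑Strings (suc m) f ∎
  where
  open ≡-Reasoning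
  ss = allStrings m

length-filter-T? : ∀ (p : Bitstring → Bool) ss →
                   length (filter (λ s → T? (p s)) ss) ≡ sum (map (𝟙 ∘ p) ss)
length-filter-T? p [] = refl
length-filter-T? p (s ∷ ss) with p s
... | true = cong suc (length-filter-T? p ss)
... | false = length-filter-T? p ss

G-as-∑Strings : ∀ m a b → G m a b ≡ ∑Strings m (𝟙 ∘ good a b)
G-as-∑Strings m a b =
  trans (length-filter-T? (good a b) (allStrings m)) (sum-map-allStrings m (𝟙 ∘ good a b))

∑Strings-cong : ∀ m {f g : Bitstring → ℕ} → (∀ s → f s ≡ g s) → ∑Strings m f ≡ ∑Strings m g
∑Strings-cong zero f≗g = f≗g []
∑Strings-cong (suc m) f≗g =
  cong₂ _+_ (∑Strings-cong m (f≗g ∘ (false ∷_))) (∑Strings-cong m (f≗g ∘ (true ∷_)))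

∑Strings-zero : ∀ m {f : Bitstring → ℕ} → (∀ s → length s ≡ m → f s ≡ 0) → ∑Strings m f ≡ 0
∑Strings-zero zero f≗0 = f≗0 [] refl
∑Strings-zero (suc m) f≗0 =
  cong₂ _+_ (∑Strings-zero m λ s ∣s∣ → f≗0 (false ∷ s) (cong suc ∣s∣))
            (∑Strings-zero m λ s ∣s∣ → f≗0 (true ∷ s) (cong suc ∣s∣))

∑Strings-∑ : ∀ m k (F : ℕ → Bitstring → ℕ) →
             ∑Strings m (λ s → ∑[ j < k ] F j s) ≡ ∑[ j < k ] ∑Strings m (F j)
∑Strings-∑ zero k F = refl
∑Strings-∑ (suc m) k F =
  trans (cong₂ _+_ (∑Strings-∑ m k λ j → F j ∘ (false ∷_)) (∑Strings-∑ m k λ j → F j ∘ (true ∷_)))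
        (sym (∑-+ k _ _))

zeros≤length : ∀ s → zeros s ≤ length s
zeros≤length [] = z≤n
zeros≤length (false ∷ s) = s≤s (zeros≤length s)
zeros≤length (true ∷ s) = m≤n⇒m≤1+n (zeros≤length s)

∑Strings-replicate : ∀ m {f : Bitstring → ℕ} → (∀ s → length s ≡ m → zeros s ≢ m → f s ≡ 0) →
                     ∑Strings m f ≡ f (replicate m false)
∑Strings-replicate zero _ = refl
∑Strings-replicate (suc m) {f} f≗0 =
  trans (cong₂ _+_
          (∑Strings-replicate m λ s ∣s∣ z≢m → f≗0 (false ∷ s) (cong suc ∣s∣) (z≢m ∘ suc-injective))
          (∑Strings-zero m λ s ∣s∣ → f≗0 (true ∷ s) (cong suc ∣s∣) (<⇒≢ (s≤s (zeros≤m s ∣s∣)))))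
        (+-identityʳ (f (replicate (suc m) false)))
  where
  zeros≤m : ∀ s → length s ≡ m → zeros s ≤ m
  zeros≤m s ∣s∣ = ≤-trans (zeros≤length s) (≤-reflexive ∣s∣)

∑Strings-byFirstOne : ∀ m (f : Bitstring → ℕ) → ∑Strings m f ≡
  ∑[ i < m ] ∑Strings (m ∸ suc i) (λ t → f (replicate i false ++ true ∷ t)) + f (replicate m false)
∑Strings-byFirstOne zero f = refl
∑Strings-byFirstOne (suc m) f = begin
  ∑Strings m (f ∘ (false ∷_)) + leadingOne
    ≡⟨ cong (_+ leadingOne) (∑Strings-byFirstOne m (f ∘ (false ∷_))) ⟩
  (laterOne + allZeros) + leadingOne ≡⟨ +-comm (laterOne + allZeros) leadingOne ⟩
  leadingOne + (laterOne + allZeros) ≡⟨ sym (+-assoc leadingOne laterOne allZeros) ⟩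
  leadingOne + laterOne + allZeros ∎
  where
  open ≡-Reasoning
  leadingOne = ∑Strings m (f ∘ (true ∷_))
  laterOne = ∑[ i < m ] ∑Strings (m ∸ suc i) (λ t → f (false ∷ replicate i false ++ true ∷ t))
  allZeros = f (replicate (suc m) false)

zeros-replicate : ∀ m → zeros (replicate m false) ≡ m
zeros-replicate zero = refl
zeros-replicate (suc m) = cong suc (zeros-replicate m)

zeros-replicate-++ : ∀ i s → zeros (replicate i false ++ s) ≡ i + zeros s
zeros-replicate-++ zero s = refl
zeros-replicate-++ (suc i) s = cong suc (zeros-replicate-++ i s)

longestRunFrom-replicate : ∀ m c → longestRunFrom c (replicate m false) ≡ c + m
longestRunFrom-replicate zero c = sym (+-identityʳ c)
longestRunFrom-replicate (suc m) c = trans (longestRunFrom-replicate m (suc c)) (sym (+-suc c m))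

longestZeroRun-replicate : ∀ m → longestZeroRun (replicate m false) ≡ m
longestZeroRun-replicate m = longestRunFrom-replicate m 0

longestRunFrom-replicate-++ : ∀ i c s → longestRunFrom c (replicate i false ++ s) ≡ longestRunFrom (c + i) s
longestRunFrom-replicate-++ zero c s = cong (λ d → longestRunFrom d s) (sym (+-identityʳ c))
longestRunFrom-replicate-++ (suc i) c s =
  trans (longestRunFrom-replicate-++ i (suc c) s) (cong (λ d → longestRunFrom d s) (sym (+-suc c i)))

isSolus-replicate : ∀ m → isSolus (replicate m false) ≡ true
isSolus-replicate zero = refl
isSolus-replicate (suc m) = isSolus-replicate m

isSolus-replicate-++ : ∀ i s → isSolus (replicate i false ++ s) ≡ isSolus s
isSolus-replicate-++ zero s = refl
isSolus-replicate-++ (suc i) s = isSolus-replicate-++ i s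

lastBit-replicate : ∀ m → lastBit false (replicate m false) ≡ false
lastBit-replicate zero = refl
lastBit-replicate (suc m) = lastBit-replicate m

lastBit-replicate-++ : ∀ i b c s → lastBit b (replicate i false ++ c ∷ s) ≡ lastBit c s
lastBit-replicate-++ zero b c s = refl
lastBit-replicate-++ (suc i) b c s = lastBit-replicate-++ i false c s

pinnedSolus : Bitstring → Bool
pinnedSolus s = isPinned s ∧ isSolus s

pinnedSolus-replicate : ∀ m → pinnedSolus (replicate m false) ≡ (0 <ᵇ m)
pinnedSolus-replicate zero = refl
pinnedSolus-replicate (suc m) rewrite lastBit-replicate m | isSolus-replicate m = refl

pinnedSolus⇒0<zeros : ∀ s → T (pinnedSolus s) → 0 < zeros s
pinnedSolus⇒0<zeros (false ∷ s) _ = z<s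
pinnedSolus⇒0<zeros [] ()
pinnedSolus⇒0<zeros (true ∷ s) ()

good-pinnedSolus : ∀ a b s → good a b s ≡ pinnedSolus s ∧ ((zeros s ≡ᵇ a) ∧ (longestZeroRun s ≡ᵇ b))
good-pinnedSolus a b s = sym (∧-assoc (isPinned s) (isSolus s) _)

T-good : ∀ {a b} s → T (good a b s) → zeros s ≡ a × longestZeroRun s ≡ b
T-good {a} {b} s g with T-∧₃ {pinnedSolus s} (subst T (good-pinnedSolus a b s) g)
... | _ , z≡a , L≡b = ≡ᵇ⇒≡ _ _ z≡a , ≡ᵇ⇒≡ _ _ L≡b

good-zeros≢ : ∀ {a b} s → zeros s ≢ a → good a b s ≡ false
good-zeros≢ {a} {b} s z≢a rewrite good-pinnedSolus a b s | ≡ᵇ-false z≢a = ∧-zeroʳ (pinnedSolus s)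

good-replicate : ∀ m a b → good a b (replicate m false) ≡ (0 <ᵇ m) ∧ ((m ≡ᵇ a) ∧ (m ≡ᵇ b))
good-replicate m a b rewrite good-pinnedSolus a b (replicate m false) | pinnedSolus-replicate m
  | zeros-replicate m | longestZeroRun-replicate m = refl

tailGood : ℕ → ℕ → ℕ → Bitstring → Bool
tailGood j x y t = pinnedSolus t ∧ ((j + zeros t ≡ᵇ x) ∧ (j ⊔ longestZeroRun t ≡ᵇ y))

good-leadingRun : ∀ i x y t → good x y (replicate (suc i) false ++ true ∷ t) ≡ tailGood (suc i) x y t
good-leadingRun i x y [] rewrite lastBit-replicate-++ i false true [] = refl
good-leadingRun i x y (true ∷ t) rewrite isSolus-replicate-++ i (true ∷ true ∷ t) = ∧-zeroʳ _
good-leadingRun i x y (false ∷ t)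
  rewrite lastBit-replicate-++ i false true (false ∷ t) | isSolus-replicate-++ i (true ∷ false ∷ t)
        | zeros-replicate-++ i (true ∷ false ∷ t) | longestRunFrom-replicate-++ i 1 (true ∷ false ∷ t)
  = sym (∧-assoc (isPinned (false ∷ t)) (isSolus t) _)

+-≡ᵇ : ∀ {j x} z → j ≤ x → (j + z ≡ᵇ x) ≡ (z ≡ᵇ x ∸ j)
+-≡ᵇ {j} {x} z j≤x = ≡ᵇ-cong (λ e → trans (sym (m+n∸m≡n j z)) (cong (_∸ j) e))
                             (λ e → trans (cong (j +_) e) (m+[n∸m]≡n j≤x))

⊔-≡ᵇ-below : ∀ {j y} l → j < y → (j ⊔ l ≡ᵇ y) ≡ (l ≡ᵇ y)
⊔-≡ᵇ-below {j} {y} l j<y = ≡ᵇ-cong to from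
  where
  to : j ⊔ l ≡ y → l ≡ y
  to e with ≤-total l j
  ... | inj₁ l≤j = contradiction (trans (sym (m≥n⇒m⊔n≡m l≤j)) e) (<⇒≢ j<y)
  ... | inj₂ j≤l = trans (sym (m≤n⇒m⊔n≡n j≤l)) e
  from : l ≡ y → j ⊔ l ≡ y
  from refl = m≤n⇒m⊔n≡n (<⇒≤ j<y)

⊔-≡ᵇ-self : ∀ y l → (y ⊔ l ≡ᵇ y) ≡ (l <ᵇ suc y)
⊔-≡ᵇ-self y l =
  T-injective (λ e → <⇒<ᵇ (s≤s (≤-trans (m≤n⊔m y l) (≤-reflexive (≡ᵇ⇒≡ _ _ e)))))
              (λ l<1+y → ≡⇒≡ᵇ _ _ (m≥n⇒m⊔n≡m (s≤s⁻¹ (<ᵇ⇒< l (suc y) l<1+y))))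

⊔-≡ᵇ-above : ∀ {j y} l → y < j → (j ⊔ l ≡ᵇ y) ≡ false
⊔-≡ᵇ-above {j} l y<j = ≡ᵇ-false λ e → <⇒≱ y<j (≤-trans (m≤m⊔n j l) (≤-reflexive e))

tailCount : ℕ → ℕ → ℕ → ℕ → ℕ
tailCount m j x y = ∑Strings m (𝟙 ∘ tailGood j x y)

-- A string starting with 1 is not pinned, and the all-zero string has too many zeros.
G-byLeadingRun : ∀ n x y → x ≤ n → G (suc n) x y ≡ ∑[ i < n ] tailCount (n ∸ suc i) (suc i) x y
G-byLeadingRun n x y x≤n = begin
  G (suc n) x y                                  ≡⟨ G-as-∑Strings (suc n) x y ⟩
  ∑Strings (suc n) (𝟙 ∘ good x y)                ≡⟨ ∑Strings-byFirstOne (suc n) (𝟙 ∘ good x y) ⟩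
  ∑Strings n (λ _ → 0) + ∑[ i < n ] afterRun i + 𝟙 (good x y (replicate (suc n) false))
    ≡⟨ cong₂ _+_ (cong₂ _+_ (∑Strings-zero n λ _ _ → refl) (∑-cong n λ i _ → afterRun≡tailCount i))
                 (cong 𝟙 allZeros-bad) ⟩
  ∑[ i < n ] tailCount (n ∸ suc i) (suc i) x y + 0 ≡⟨ +-identityʳ _ ⟩
  ∑[ i < n ] tailCount (n ∸ suc i) (suc i) x y   ∎
  where
  open ≡-Reasoning
  afterRun : ℕ → ℕ
  afterRun i = ∑Strings (n ∸ suc i) (λ t → 𝟙 (good x y (replicate (suc i) false ++ true ∷ t)))
  afterRun≡tailCount : ∀ i → afterRun i ≡ tailCount (n ∸ suc i) (suc i) x y
  afterRun≡tailCount i = ∑Strings-cong (n ∸ suc i) λ t → cong 𝟙 (good-leadingRun i x y t)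
  allZeros-bad : good x y (replicate (suc n) false) ≡ false
  allZeros-bad = good-zeros≢ (replicate (suc n) false)
                   λ e → <⇒≢ (s≤s x≤n) (trans (sym e) (zeros-replicate (suc n)))

tailCount-below : ∀ m {j x y} → j < y → j ≤ x → tailCount m j x y ≡ G m (x ∸ j) y
tailCount-below m {j} {x} {y} j<y j≤x = begin
  tailCount m j x y
    ≡⟨ ∑Strings-cong m (λ t → cong 𝟙 (cong₂ (λ u v → pinnedSolus t ∧ (u ∧ v))
                                            (+-≡ᵇ (zeros t) j≤x) (⊔-≡ᵇ-below (longestZeroRun t) j<y))) ⟩
  ∑Strings m (λ t → 𝟙 (pinnedSolus t ∧ ((zeros t ≡ᵇ x ∸ j) ∧ (longestZeroRun t ≡ᵇ y))))
    ≡⟨ ∑Strings-cong m (λ t → cong 𝟙 (sym (good-pinnedSolus (x ∸ j) y t))) ⟩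
  ∑Strings m (𝟙 ∘ good (x ∸ j) y)
    ≡⟨ sym (G-as-∑Strings m (x ∸ j) y) ⟩
  G m (x ∸ j) y ∎
  where open ≡-Reasoning

tailGood-at : ∀ {x y} → y ≤ x → ∀ t → 𝟙 (tailGood y x y t) ≡ ∑[ l < suc y ] 𝟙 (good (x ∸ y) l t)
tailGood-at {x} {y} y≤x t = begin
  𝟙 (pinnedSolus t ∧ ((y + zeros t ≡ᵇ x) ∧ (y ⊔ L ≡ᵇ y)))
    ≡⟨ cong₂ (λ u v → 𝟙 (pinnedSolus t ∧ (u ∧ v))) (+-≡ᵇ (zeros t) y≤x) (⊔-≡ᵇ-self y L) ⟩
  𝟙 (pinnedSolus t ∧ ((zeros t ≡ᵇ x ∸ y) ∧ (L <ᵇ suc y)))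
    ≡⟨ 𝟙-∧-∧ (pinnedSolus t) _ _ ⟩
  p * 𝟙 (L <ᵇ suc y)
    ≡⟨ cong (p *_) (sym (∑-𝟙≡ (suc y) L)) ⟩
  p * ∑[ l < suc y ] 𝟙 (L ≡ᵇ l)
    ≡⟨ sym (∑-*ˡ (suc y) p (λ l → 𝟙 (L ≡ᵇ l))) ⟩
  ∑[ l < suc y ] (p * 𝟙 (L ≡ᵇ l))
    ≡⟨ ∑-cong (suc y) (λ l _ →
         trans (sym (𝟙-∧-∧ (pinnedSolus t) (zeros t ≡ᵇ x ∸ y) (L ≡ᵇ l)))
               (cong 𝟙 (sym (good-pinnedSolus (x ∸ y) l t)))) ⟩
  ∑[ l < suc y ] 𝟙 (good (x ∸ y) l t) ∎
  where
  open ≡-Reasoning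
  L = longestZeroRun t
  p = 𝟙 (pinnedSolus t ∧ (zeros t ≡ᵇ x ∸ y))

tailCount-at : ∀ m {x y} → y ≤ x → tailCount m y x y ≡ ∑[ l < suc y ] G m (x ∸ y) l
tailCount-at m {x} {y} y≤x =
  trans (∑Strings-cong m (tailGood-at y≤x))
        (trans (∑Strings-∑ m (suc y) λ l → 𝟙 ∘ good (x ∸ y) l)
               (∑-cong (suc y) λ l _ → sym (G-as-∑Strings m (x ∸ y) l)))

tailCount-above : ∀ m {j x y} → y < j → tailCount m j x y ≡ 0
tailCount-above m {j} {x} {y} y<j = ∑Strings-zero m λ t _ →
  cong 𝟙 (trans (cong (λ v → pinnedSolus t ∧ ((j + zeros t ≡ᵇ x) ∧ v))
                      (⊔-≡ᵇ-above (longestZeroRun t) y<j))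
                (trans (cong (pinnedSolus t ∧_) (∧-zeroʳ _)) (∧-zeroʳ _)))

tailCount-full : ∀ m j y → tailCount m j (j + m) y ≡ 𝟙 ((0 <ᵇ m) ∧ (j ⊔ m ≡ᵇ y))
tailCount-full m j y = trans (∑Strings-replicate m vanish) evaluate
  where
  vanish : ∀ t → length t ≡ m → zeros t ≢ m → 𝟙 (tailGood j (j + m) y t) ≡ 0
  vanish t _ z≢m rewrite ≡ᵇ-false (z≢m ∘ +-cancelˡ-≡ j (zeros t) m) = cong 𝟙 (∧-zeroʳ (pinnedSolus t))
  evaluate : 𝟙 (tailGood j (j + m) y (replicate m false)) ≡ 𝟙 ((0 <ᵇ m) ∧ (j ⊔ m ≡ᵇ y))
  evaluate rewrite pinnedSolus-replicate m | zeros-replicate m | longestZeroRun-replicate m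
    | ≡ᵇ-refl (j + m) = refl

recSum-as-∑ : ∀ k x y → recSum (suc k) x (suc y) ≡
  ∑[ i < y ] G (k ∸ suc i) (x ∸ suc i) (suc y) + ∑[ l < suc (suc y) ] G (k ∸ suc y) (x ∸ suc y) l
recSum-as-∑ k x y = cong₂ _+_
  (trans (cong sum (map-applyUpTo suc (λ i → G (suc k ∸ i ∸ 1) (x ∸ i) (suc y)) y))
         (∑-cong y λ i _ → cong (λ m → G m (x ∸ suc i) (suc y)) (pred[m∸n]≡m∸[1+n] k i)))
  (trans (cong sum (map-applyUpTo (λ l → l) (G (k ∸ y ∸ 1) (x ∸ suc y)) (suc (suc y))))
         (∑-cong (suc (suc y)) λ l _ → cong (λ m → G m (x ∸ suc y) l) (pred[m∸n]≡m∸[1+n] k y)))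

G-recursion : ∀ k x y → 1 ≤ y → y ≤ x → x ≤ k ∸ 1 → G (suc k) x y ≡ recSum (suc k) x y
G-recursion k x (suc y) _ y<x x≤k-1 = begin
  G (suc k) x (suc y)
    ≡⟨ G-byLeadingRun k x (suc y) (≤-trans x≤k-1 (m∸n≤m k 1)) ⟩
  ∑< k F
    ≡⟨ cong (λ l → ∑< l F) (sym y+[1+r]≡k) ⟩
  ∑< (y + suc r) F
    ≡⟨ ∑-split y (suc r) F ⟩
  ∑< y F + (F (y + 0) + ∑[ i < r ] F (y + suc i))
    ≡⟨ cong₂ _+_ (∑-cong y λ i i<y → tailCount-below (k ∸ suc i) (s<s i<y) (≤-trans i<y (<⇒≤ y<x)))
                 (cong₂ _+_ (trans (cong F (+-identityʳ y)) (tailCount-at (k ∸ suc y) y<x))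
                            (∑-zero r λ i _ → tailCount-above (k ∸ suc (y + suc i)) {x = x}
                                                               (s<s (m<m+n y z<s)))) ⟩
  ∑[ i < y ] G (k ∸ suc i) (x ∸ suc i) (suc y) + (∑[ l < suc (suc y) ] G (k ∸ suc y) (x ∸ suc y) l + 0)
    ≡⟨ cong (∑[ i < y ] G (k ∸ suc i) (x ∸ suc i) (suc y) +_) (+-identityʳ _) ⟩
  ∑[ i < y ] G (k ∸ suc i) (x ∸ suc i) (suc y) + ∑[ l < suc (suc y) ] G (k ∸ suc y) (x ∸ suc y) l
    ≡⟨ sym (recSum-as-∑ k x y) ⟩
  recSum (suc k) x (suc y) ∎
  where
  open ≡-Reasoning
  F : ℕ → ℕ
  F i = tailCount (k ∸ suc i) (suc i) x (suc y)
  r = k ∸ suc y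
  y+[1+r]≡k : y + suc r ≡ k
  y+[1+r]≡k = trans (+-suc y r) (m+[n∸m]≡n (≤-trans y<x (≤-trans x≤k-1 (m∸n≤m k 1))))

G-diagonal : ∀ k → G (suc k) (suc k) (suc k) ≡ 1
G-diagonal k = begin
  G n n n                          ≡⟨ G-as-∑Strings n n n ⟩
  ∑Strings n (𝟙 ∘ good n n)
    ≡⟨ ∑Strings-replicate n {𝟙 ∘ good n n} (λ s _ → cong 𝟙 ∘ good-zeros≢ s) ⟩
  𝟙 (good n n (replicate n false)) ≡⟨ cong 𝟙 (good-replicate n n n) ⟩
  𝟙 ((k ≡ᵇ k) ∧ (k ≡ᵇ k))          ≡⟨ cong (λ b → 𝟙 (b ∧ b)) (≡ᵇ-refl k) ⟩
  1 ∎
  where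
  open ≡-Reasoning
  n = suc k

<+⇒0< : ∀ {a b y} → a ≤ y → y < a + b → 0 < b
<+⇒0< {a} {zero} a≤y y<a+0 = contradiction (≤-trans y<a+0 (≤-reflexive (+-identityʳ a))) (≤⇒≯ a≤y)
<+⇒0< {b = suc b} _ _ = z<s

𝟙-⊔≡-split : ∀ a b y → y < a + b → a + b ≤ y + y →
             𝟙 ((0 <ᵇ b) ∧ (a ⊔ b ≡ᵇ y)) ≡ 𝟙 (y ≡ᵇ a) + 𝟙 (b ≡ᵇ y) * 𝟙 (a <ᵇ y)
𝟙-⊔≡-split a b y y<a+b a+b≤y+y with <-cmp a y
... | tri< a<y _ _ rewrite <ᵇ-true (<+⇒0< (<⇒≤ a<y) y<a+b) | ⊔-≡ᵇ-below b a<y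
                         | ≡ᵇ-false (≢-sym (<⇒≢ a<y)) | <ᵇ-true a<y = sym (*-identityʳ _)
... | tri≈ _ refl _ rewrite <ᵇ-true (<+⇒0< ≤-refl y<a+b) | m≥n⇒m⊔n≡m (+-cancelˡ-≤ a b a a+b≤y+y)
                          | ≡ᵇ-refl a | <ᵇ-false (n≮n a) = cong suc (sym (*-zeroʳ (𝟙 (b ≡ᵇ a))))
... | tri> _ _ y<a rewrite ⊔-≡ᵇ-above b y<a | ≡ᵇ-false (<⇒≢ y<a) | <ᵇ-false (<⇒≯ y<a)
  = trans (cong 𝟙 (∧-zeroʳ _)) (sym (*-zeroʳ (𝟙 (b ≡ᵇ y))))

∸-swap : ∀ {x a b} → a < x → x ∸ suc a ≡ b → x ∸ suc b ≡ a
∸-swap {x} {a} {b} a<x x∸[1+a]≡b = begin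
  x ∸ suc b                     ≡⟨ cong (_∸ suc b) (sym (m+[n∸m]≡n a<x)) ⟩
  (suc a + (x ∸ suc a)) ∸ suc b ≡⟨ cong (λ c → (suc a + c) ∸ suc b) x∸[1+a]≡b ⟩
  (suc a + b) ∸ suc b           ≡⟨ cong (_∸ suc b) (sym (+-suc a b)) ⟩
  (a + suc b) ∸ suc b           ≡⟨ m+n∸n≡m a (suc b) ⟩
  a ∎
  where open ≡-Reasoning

-- The two parts of the split count the position j = y and, when x − y < y, the position j = x − y.
∑-lastColumn : ∀ x y → y < x → x ≤ y + y →
               ∑[ i < x ] 𝟙 ((0 <ᵇ x ∸ suc i) ∧ (suc i ⊔ (x ∸ suc i) ≡ᵇ y)) ≡ 1 + 𝟙 (x <ᵇ y + y)
∑-lastColumn x zero 0<x x≤0 = contradiction x≤0 (<⇒≱ 0<x)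
∑-lastColumn x y@(suc y') y<x x≤y+y = begin
  ∑[ i < x ] 𝟙 ((0 <ᵇ x ∸ suc i) ∧ (suc i ⊔ (x ∸ suc i) ≡ᵇ y))
    ≡⟨ ∑-cong x split ⟩
  ∑[ i < x ] (𝟙 (y' ≡ᵇ i) + 𝟙 (x ∸ suc i ≡ᵇ y) * 𝟙 (suc i <ᵇ y))
    ≡⟨ ∑-+ x (λ i → 𝟙 (y' ≡ᵇ i)) (λ i → 𝟙 (x ∸ suc i ≡ᵇ y) * 𝟙 (suc i <ᵇ y)) ⟩
  ∑[ i < x ] 𝟙 (y' ≡ᵇ i) + ∑[ i < x ] (𝟙 (x ∸ suc i ≡ᵇ y) * 𝟙 (suc i <ᵇ y))
    ≡⟨ cong₂ _+_ (trans (∑-𝟙≡ x y') (cong 𝟙 (<ᵇ-true (<-trans (n<1+n y') y<x))))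
                 (∑-cong x λ i i<x → cong (λ b → 𝟙 b * 𝟙 (suc i <ᵇ y))
                                          (≡ᵇ-cong (∸-swap i<x) (∸-swap y<x))) ⟩
  1 + ∑[ i < x ] (𝟙 (c ≡ᵇ i) * 𝟙 (suc i <ᵇ y))
    ≡⟨ cong (1 +_) (∑-select x c (λ i → 𝟙 (suc i <ᵇ y)) (∸-monoʳ-< z<s y<x)) ⟩
  1 + 𝟙 (suc c <ᵇ y)
    ≡⟨ cong (λ b → 1 + 𝟙 b) (<ᵇ-cong 1+c<y⇒x<y+y x<y+y⇒1+c<y) ⟩
  1 + 𝟙 (x <ᵇ y + y) ∎
  where
  open ≡-Reasoning
  split : ∀ i → i < x → 𝟙 ((0 <ᵇ x ∸ suc i) ∧ (suc i ⊔ (x ∸ suc i) ≡ᵇ y))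
                        ≡ 𝟙 (y' ≡ᵇ i) + 𝟙 (x ∸ suc i ≡ᵇ y) * 𝟙 (suc i <ᵇ y)
  split i i<x = 𝟙-⊔≡-split (suc i) (x ∸ suc i) y (subst (y <_) x≡ y<x) (subst (_≤ y + y) x≡ x≤y+y)
    where x≡ = sym (m+[n∸m]≡n i<x)
  c = x ∸ suc y
  y+[1+c]≡x : y + suc c ≡ x
  y+[1+c]≡x = trans (+-suc y c) (m+[n∸m]≡n y<x)
  1+c<y⇒x<y+y : suc c < y → x < y + y
  1+c<y⇒x<y+y 1+c<y = subst (_< y + y) y+[1+c]≡x (+-monoʳ-< y 1+c<y)
  x<y+y⇒1+c<y : x < y + y → suc c < y
  x<y+y⇒1+c<y x<y+y = +-cancelˡ-< y (suc c) y (subst (_< y + y) (sym y+[1+c]≡x) x<y+y)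

G-lastColumn-count : ∀ x y → y < x → x ≤ y + y → G (suc x) x y ≡ 1 + 𝟙 (x <ᵇ y + y)
G-lastColumn-count x y y<x x≤y+y = begin
  G (suc x) x y
    ≡⟨ G-byLeadingRun x x y ≤-refl ⟩
  ∑[ i < x ] tailCount (x ∸ suc i) (suc i) x y
    ≡⟨ ∑-cong x (λ i i<x → trans (cong (λ z → tailCount (x ∸ suc i) (suc i) z y) (sym (m+[n∸m]≡n i<x)))
                                  (tailCount-full (x ∸ suc i) (suc i) y)) ⟩
  ∑[ i < x ] 𝟙 ((0 <ᵇ x ∸ suc i) ∧ (suc i ⊔ (x ∸ suc i) ≡ᵇ y))
    ≡⟨ ∑-lastColumn x y y<x x≤y+y ⟩
  1 + 𝟙 (x <ᵇ y + y) ∎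
  where open ≡-Reasoning

even⊎odd : ∀ x → ∃ λ t → x ≡ t + t ⊎ x ≡ suc (t + t)
even⊎odd zero = 0 , inj₁ refl
even⊎odd (suc x) with even⊎odd x
... | t , inj₁ refl = t , inj₂ refl
... | t , inj₂ refl = suc t , inj₁ (cong suc (sym (+-suc t t)))

[2+m]/2≡1+m/2 : ∀ m → suc (suc m) / 2 ≡ suc (m / 2)
[2+m]/2≡1+m/2 m = m/n≡1+[m∸n]/n {suc (suc m)} {2} (s≤s (s≤s z≤n))

[2+m]%2≡m%2 : ∀ m → suc (suc m) % 2 ≡ m % 2
[2+m]%2≡m%2 m = trans (cong (_% 2) (+-comm 2 m)) ([m+n]%n≡m%n m 2)

[t+t]/2≡t : ∀ t → (t + t) / 2 ≡ t
[t+t]/2≡t zero = refl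
[t+t]/2≡t (suc t) rewrite +-suc t t = trans ([2+m]/2≡1+m/2 (t + t)) (cong suc ([t+t]/2≡t t))

[1+t+t]/2≡t : ∀ t → suc (t + t) / 2 ≡ t
[1+t+t]/2≡t zero = refl
[1+t+t]/2≡t (suc t) rewrite +-suc t t = trans ([2+m]/2≡1+m/2 (suc (t + t))) (cong suc ([1+t+t]/2≡t t))

[t+t]%2≡0 : ∀ t → (t + t) % 2 ≡ 0
[t+t]%2≡0 zero = refl
[t+t]%2≡0 (suc t) rewrite +-suc t t = trans ([2+m]%2≡m%2 (t + t)) ([t+t]%2≡0 t)

[1+t+t]%2≡1 : ∀ t → suc (t + t) % 2 ≡ 1
[1+t+t]%2≡1 zero = refl
[1+t+t]%2≡1 (suc t) rewrite +-suc t t = trans ([2+m]%2≡m%2 (suc (t + t))) ([1+t+t]%2≡1 t)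

half-bound : ∀ {k y} → suc k / 2 ≤ y → k ≤ y + y
half-bound {k} {y} half≤y with even⊎odd k
... | t , inj₁ refl = +-mono-≤ t≤y t≤y
  where t≤y = subst (_≤ y) ([1+t+t]/2≡t t) half≤y
... | t , inj₂ refl = ≤-trans (s≤s (+-monoʳ-≤ t (n≤1+n t))) (+-mono-≤ t<y t<y)
  where t<y = subst (_≤ y) (trans ([2+m]/2≡1+m/2 (t + t)) (cong suc ([t+t]/2≡t t))) half≤y

lam-even : ∀ t y → t ≤ y → y < t + t → lam (suc (t + t)) y ≡ 1 + 𝟙 (t + t <ᵇ y + y)
lam-even t y t≤y y<2t with y ≟ t
... | yes refl rewrite [1+t+t]%2≡1 y | [t+t]/2≡t y | ≡ᵇ-refl y | <ᵇ-false (n≮n (y + y)) = refl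
... | no y≢t with ≤∧≢⇒< t≤y (≢-sym y≢t)
...   | t<y rewrite [1+t+t]%2≡1 t | [t+t]/2≡t t | ≡ᵇ-false y≢t | <ᵇ-true t<y | <ᵇ-true y<2t
                  | <ᵇ-true (+-mono-< t<y t<y) = refl

lam-odd : ∀ t y → t < y → y < suc (t + t) → lam (suc (suc (t + t))) y ≡ 1 + 𝟙 (suc (t + t) <ᵇ y + y)
lam-odd t y t<y y<1+2t
  rewrite [2+m]%2≡m%2 (t + t) | [t+t]%2≡0 t | [1+t+t]/2≡t t | <ᵇ-true t<y | <ᵇ-true y<1+2t
        | <ᵇ-true (subst (_≤ y + y) (cong suc (+-suc t t)) (+-mono-≤ t<y t<y)) = refl

lam-eval : ∀ x y → suc x / 2 ≤ y → y < x → lam (suc x) y ≡ 1 + 𝟙 (x <ᵇ y + y)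
lam-eval x y half≤y y<x with even⊎odd x
... | t , inj₁ refl = lam-even t y (subst (_≤ y) ([1+t+t]/2≡t t) half≤y) y<x
... | t , inj₂ refl =
  lam-odd t y (subst (_≤ y) (trans ([2+m]/2≡1+m/2 (t + t)) (cong suc ([t+t]/2≡t t))) half≤y) y<x

G-lastColumn : ∀ k x y → x ≡ k → suc k / suc (suc k ∸ x) ≤ y → y < x → G (suc k) x y ≡ lam (suc k) y
G-lastColumn k .k y refl quotient≤y y<k =
  trans (G-lastColumn-count k y y<k (half-bound half≤y)) (sym (lam-eval k y half≤y y<k))
  where
  half≤y : suc k / 2 ≤ y
  half≤y = subst (λ d → suc k / suc d ≤ y) (m+n∸n≡m 1 k) quotient≤y

ones : Bitstring → ℕ
ones [] = 0
ones (false ∷ s) = ones s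
ones (true ∷ s) = suc (ones s)

length≡zeros+ones : ∀ s → length s ≡ zeros s + ones s
length≡zeros+ones [] = refl
length≡zeros+ones (false ∷ s) = cong suc (length≡zeros+ones s)
length≡zeros+ones (true ∷ s) = trans (cong suc (length≡zeros+ones s)) (sym (+-suc (zeros s) (ones s)))

longestRunFrom≤ : ∀ c s → longestRunFrom c s ≤ c + zeros s
longestRunFrom≤ c [] = ≤-reflexive (sym (+-identityʳ c))
longestRunFrom≤ c (false ∷ s) = ≤-trans (longestRunFrom≤ (suc c) s) (≤-reflexive (sym (+-suc c (zeros s))))
longestRunFrom≤ c (true ∷ s) =
  ⊔-lub (m≤m+n c (zeros s)) (≤-trans (longestRunFrom≤ 0 s) (m≤n+m (zeros s) c))

zeros+c≤[1+ones]*longestRunFrom : ∀ c s → zeros s + c ≤ suc (ones s) * longestRunFrom c s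
zeros+c≤[1+ones]*longestRunFrom c [] = ≤-reflexive (sym (*-identityˡ c))
zeros+c≤[1+ones]*longestRunFrom c (false ∷ s) =
  ≤-trans (≤-reflexive (sym (+-suc (zeros s) c))) (zeros+c≤[1+ones]*longestRunFrom (suc c) s)
zeros+c≤[1+ones]*longestRunFrom c (true ∷ s) = begin
  zeros s + c                              ≡⟨ +-comm (zeros s) c ⟩
  c + zeros s                              ≡⟨ cong (c +_) (sym (+-identityʳ (zeros s))) ⟩
  c + (zeros s + 0)                        ≤⟨ +-mono-≤ (m≤m⊔n c L) (zeros+c≤[1+ones]*longestRunFrom 0 s) ⟩
  c ⊔ L + suc (ones s) * L                 ≤⟨ +-monoʳ-≤ (c ⊔ L) (*-monoʳ-≤ (suc (ones s)) (m≤n⊔m c L)) ⟩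
  c ⊔ L + suc (ones s) * (c ⊔ L)           ∎
  where
  open ≤-Reasoning
  L = longestRunFrom 0 s

longestZeroRun-lowerBound : ∀ s → length s / suc (length s ∸ zeros s) ≤ longestZeroRun s
longestZeroRun-lowerBound s rewrite length≡zeros+ones s | m+n∸m≡n (zeros s) (ones s) =
  s≤s⁻¹ (m<n*o⇒m/o<n (begin-strict
    zeros s + ones s            ≡⟨ +-comm (zeros s) (ones s) ⟩
    ones s + zeros s            <⟨ +-monoˡ-< (zeros s) (n<1+n (ones s)) ⟩
    suc (ones s) + zeros s      ≤⟨ +-monoʳ-≤ (suc (ones s)) (≤-trans (≤-reflexive (sym (+-identityʳ (zeros s))))
                                                                    (zeros+c≤[1+ones]*longestRunFrom 0 s)) ⟩
    suc (ones s) + suc (ones s) * longestZeroRun s ≡⟨ sym (*-suc (suc (ones s)) (longestZeroRun s)) ⟩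
    suc (ones s) * suc (longestZeroRun s) ≡⟨ *-comm (suc (ones s)) (suc (longestZeroRun s)) ⟩
    suc (longestZeroRun s) * suc (ones s) ∎))
  where open ≤-Reasoning

decompose : ∀ s → s ≡ replicate (length s) false ⊎ ∃₂ λ i t → s ≡ replicate i false ++ true ∷ t
decompose [] = inj₁ refl
decompose (true ∷ s) = inj₂ (0 , s , refl)
decompose (false ∷ s) with decompose s
... | inj₁ s≡0ⁿ = inj₁ (cong (false ∷_) s≡0ⁿ)
... | inj₂ (i , t , s≡0ⁱ1t) = inj₂ (suc i , t , cong (false ∷_) s≡0ⁱ1t)

leadingRun-bound : ∀ i t → 0 < zeros t → suc i ⊔ longestZeroRun t < suc i + zeros t
leadingRun-bound i t 0<z =
  ⊔-lub (m<m+n (suc i) 0<z) (s≤s (≤-trans (longestRunFrom≤ 0 t) (m≤n+m (zeros t) i)))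

good-classification : ∀ {n x y} s → length s ≡ n → T (good x y s) →
                      (x ≡ n × y ≡ n) ⊎ (1 ≤ x × x < n × EpsOne n x y)
good-classification {x = x} {y} s refl g with T-good s g | decompose s
... | z≡x , L≡y | inj₁ s≡0ⁿ =
  inj₁ ( trans (sym z≡x) (trans (cong zeros s≡0ⁿ) (zeros-replicate (length s)))
       , trans (sym L≡y) (trans (cong longestZeroRun s≡0ⁿ) (longestZeroRun-replicate (length s))))
... | _ | inj₂ (zero , t , refl) = ⊥-elim g
... | z≡x , L≡y | inj₂ (suc i , t , refl) with T-∧₃ {pinnedSolus t} (subst T (good-leadingRun i x y t) g)
... | pinned , x-sum , y-max = inj₂ (1≤x , x<n , <⇒≤ x<n , inj₁ (quotient≤y , y<x))
  where
  x≡ : suc i + zeros t ≡ x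
  x≡ = ≡ᵇ⇒≡ _ _ x-sum
  y≡ : suc i ⊔ longestZeroRun t ≡ y
  y≡ = ≡ᵇ⇒≡ _ _ y-max
  ∣s∣≡ : length s ≡ suc i + suc (length t)
  ∣s∣≡ = trans (length-++ (replicate (suc i) false))
               (cong (_+ suc (length t)) (length-replicate (suc i)))
  1≤x : 1 ≤ x
  1≤x = subst (1 ≤_) x≡ (s≤s z≤n)
  x<n : x < length s
  x<n = subst₂ _<_ x≡ (sym ∣s∣≡) (+-monoʳ-< (suc i) (s≤s (zeros≤length t)))
  y<x : y < x
  y<x = subst₂ _<_ y≡ x≡ (leadingRun-bound i t (pinnedSolus⇒0<zeros t pinned))
  quotient≤y : length s / suc (length s ∸ x) ≤ y
  quotient≤y =
    subst₂ (λ a b → length s / suc (length s ∸ a) ≤ b) z≡x L≡y (longestZeroRun-lowerBound s)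

G-zero : ∀ n x y → ¬ (x ≡ n × y ≡ n) → ¬ (1 ≤ x × x < n × EpsOne n x y) → G n x y ≡ 0
G-zero n x y ¬diag ¬interior = trans (G-as-∑Strings n x y) (∑Strings-zero n vanish)
  where
  vanish : ∀ s → length s ≡ n → 𝟙 (good x y s) ≡ 0
  vanish s ∣s∣≡n with good x y s in eq
  ... | false = refl
  ... | true = ⊥-elim ([ ¬diag , ¬interior ]′ (good-classification s ∣s∣≡n (subst T (sym eq) _)))

1≤quotient : ∀ {k x} → 1 ≤ x → 1 ≤ suc k / suc (suc k ∸ x)
1≤quotient {k} {suc x} _ = m≥n⇒m/n>0 (s≤s (m∸n≤m k x))

<1+n⇒≡n⊎≤n∸1 : ∀ {x k} → x < suc k → x ≡ k ⊎ x ≤ k ∸ 1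
<1+n⇒≡n⊎≤n∸1 x<1+k with m<1+n⇒m<n∨m≡n x<1+k
... | inj₁ x<k = inj₂ (<⇒≤pred x<k)
... | inj₂ x≡k = inj₁ x≡k

mainTheorem1 : (n : ℕ) → 1 ≤ n →
      (G n n n ≡ 1)
    × ((x y : ℕ) → y ≤ x → x ≤ n → ¬ (x ≡ n × y ≡ n) →
          ((1 ≤ x → x ≤ n ∸ 2 → EpsOne n x y → G n x y ≡ recSum n x y)
         × (x ≡ n ∸ 1 → EpsOne n x y → G n x y ≡ lam n y)
         × (¬ (1 ≤ x × x ≤ n ∸ 2 × EpsOne n x y) → ¬ (x ≡ n ∸ 1 × EpsOne n x y) → G n x y ≡ 0)))
    × (G n 0 0 ≡ 0)
mainTheorem1 (suc k) _ =
    G-diagonal k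
  , (λ x y y≤x _ ¬diag →
        (λ 1≤x x≤k-1 ε →
           G-recursion k x y (≤-trans (1≤quotient 1≤x) (proj₁ (interior ε ¬diag))) y≤x x≤k-1)
      , (λ x≡k ε → G-lastColumn k x y x≡k (proj₁ (interior ε ¬diag)) (proj₂ (interior ε ¬diag)))
      , (λ ¬recursive ¬lastColumn → G-zero (suc k) x y ¬diag λ (1≤x , x<n , ε) →
           [ (λ x≡k → ¬lastColumn (x≡k , ε)) , (λ x≤k-1 → ¬recursive (1≤x , x≤k-1 , ε)) ]′
           (<1+n⇒≡n⊎≤n∸1 x<n)))
  , G-zero (suc k) 0 0 (λ { (() , _) }) (λ { (() , _) })
  where
  interior : ∀ {n x y} → EpsOne n x y → ¬ (x ≡ n × y ≡ n) → n / suc (n ∸ x) ≤ y × y < x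
  interior (_ , inj₁ quotient≤y×y<x) _ = quotient≤y×y<x
  interior (_ , inj₂ diag) ¬diag = contradiction diag ¬diag
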